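{- Let $r \ge 2$ and let $G = K_{n_1,n_2,\ldots,n_r}$ be the complete $r$-partite graph with parts of sizes $n_1 \ge n_2 \ge \cdots \ge n_r \ge 1$, let $n = n_1 + \cdots + n_r$, and let $\alpha$ be the number of indices $i$ for which $n_i$ is odd. If $3\alpha > n$, then $\mathrm{ip}(G) = \lceil (n+\alpha)/4 \rceil$.
   Context: An isometric path between two vertices of a graph is a shortest path joining them. The isometric path number $\mathrm{ip}(G)$ of a graph $G$ is the minimum number of isometric paths needed to cover all vertices of $G$. The complete $r$-partite graph $K_{n_1,\ldots,n_r}$ has vertex set partitioned into $r$ nonempty parts of sizes $n_1,\ldots,n_r$, with two vertices adjacent if and only if they lie in different parts. -}

module Defs where

open import Data.Nat using (ℕ; zero; suc; _+_; _≤_; _%_; _/_)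
open import Data.Nat.Properties using (_≟_)
open import Data.Fin using (Fin)
open import Data.Product using (Σ; _×_; _,_)
open import Data.List using (List; length; map; filter; allFin)
open import Data.Nat.ListAction using (sum)
open import Data.List.Relation.Unary.Any using (Any)
open import Relation.Binary.PropositionalEquality using (_≡_)
open import Relation.Nullary using (¬_)

record Graph : Set₁ where
  field
    V   : Set
    Adj : V → V → Set
open Graph public

data Walk (G : Graph) : V G → V G → ℕ → Set where
  stop : ∀ {u} → Walk G u u 0
  step : ∀ {u w v k} → Adj G u w → Walk G w v k → Walk G u v (suc k)

data OnWalk (G : Graph) (x : V G) : ∀ {u v k} → Walk G u v k → Set where
  here  : ∀ {v k} {w : Walk G x v k} → OnWalk G x w
  there : ∀ {u w v k} {e : Adj G u w} {p : Walk G w v k} →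
          OnWalk G x p → OnWalk G x (step e p)

record IsoPath (G : Graph) : Set where
  constructor isoPath
  field
    start end : V G
    len       : ℕ
    walk      : Walk G start end len
    shortest  : ∀ {k} → Walk G start end k → len ≤ k
open IsoPath public

Covers : (G : Graph) → List (IsoPath G) → Set
Covers G ps = ∀ x → Any (λ p → OnWalk G x (walk p)) ps

IsIsometricPathNumber : Graph → ℕ → Set
IsIsometricPathNumber G m =
  (Σ (List (IsoPath G)) λ ps → Covers G ps × length ps ≡ m) ×
  (∀ ps → Covers G ps → m ≤ length ps)

completeMultipartite : (r : ℕ) → (Fin r → ℕ) → Graph
completeMultipartite r ns = record
  { V   = Σ (Fin r) (λ i → Fin (ns i))
  ; Adj = λ { (i , _) (j , _) → ¬ (i ≡ j) } }

totalSize : (r : ℕ) → (Fin r → ℕ) → ℕ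
totalSize r ns = sum (map ns (allFin r))

numOdd : (r : ℕ) → (Fin r → ℕ) → ℕ
numOdd r ns = length (filter (λ i → ns i % 2 ≟ 1) (allFin r))

ceil4 : ℕ → ℕ
ceil4 m = (m + 3) / 4

-- Lower bound: an isometric path in a complete multipartite graph has at most
-- three vertices, and a three-vertex one starts and ends in the same part.  So
-- each path can be charged to the parts of its first two vertices, and it
-- contains at most twice as many vertices of a part as it has charges there.
-- A part of size nᵢ is thus charged at least ⌈nᵢ/2⌉ times, and
-- 4·ip ≥ 2·Σᵢ⌈nᵢ/2⌉ = n + α.
--
-- Upper bound: pair up the vertices of each part, leaving one single vertex in
-- each odd part.  The α singles are pairwise adjacent, and the (n − α)/2 pairs
-- are fewer than the singles exactly when 3α > n.  Each pair u, v is covered by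
-- a path u – s – v through its own single s outside the part of u, and the
-- remaining singles are joined two at a time by edges, giving ⌈(n + α)/4⌉ paths.

module Submission where

open import Defs
open import Data.Nat using (ℕ; zero; suc; _+_; _*_; _%_; _≤_; _<_; z≤n; s≤s)
open import Data.Fin using (Fin; zero; suc; toℕ)
open import Data.Fin as F using ()

open import Algebra.Properties.CommutativeSemigroup using (interchange)
open import Data.Bool using (true; false; if_then_else_)
open import Data.Fin.Properties using (toℕ-injective; injective⇒≤)
open import Data.List using (List; []; _∷_; _++_; length; map; filter; take; concatMap; allFin; lookup)
open import Data.List.Membership.Propositional using (_∈_; lose)
open import Data.List.Membership.Propositional.Properties using (∈-map⁺; ∈-filter⁺; ∈-allFin)
open import Data.List.Properties using (map-++; map-∘; map-cong; map-tabulate; map-concatMap; length-++; length-map; length-take)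
open import Data.List.Relation.Binary.Permutation.Propositional using (↭-swap; ↭-refl)
open import Data.List.Relation.Binary.Permutation.Propositional.Properties using (Any-resp-↭)
open import Data.List.Relation.Unary.All as All using (All; []; _∷_)
import Data.List.Relation.Unary.All.Properties as All
open import Data.List.Relation.Unary.AllPairs as AllPairs using (AllPairs; []; _∷_)
import Data.List.Relation.Unary.AllPairs.Properties as AllPairs
open import Data.List.Relation.Unary.Any as Any using (Any; here; there; index)
import Data.List.Relation.Unary.Any.Properties as Any
open import Data.List.Relation.Unary.Unique.Propositional.Properties using (allFin⁺)
open import Data.Nat.DivMod using (m<n*o⇒m/o<n; m*n/n≡m; /-monoˡ-≤)
open import Data.Nat.ListAction using (sum)
open import Data.Nat.ListAction.Properties using (sum-++)
open import Data.Nat.Properties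
open import Data.Nat.Tactic.RingSolver using (solve-∀)
open import Data.Product using (Σ; _×_; _,_; proj₁; proj₂)
import Data.Product as Product
open import Data.Sum using (_⊎_; inj₁; inj₂)
import Data.Sum as Sum
open import Function using (_∘_; id; _∋_)
open import Function.Definitions using (Injective)
open import Relation.Binary.PropositionalEquality
open import Relation.Nullary using (¬_; Dec; yes; no; does; contradiction)
open import Relation.Unary using (Decidable)

indicator : ∀ {P : Set} → Dec P → ℕ
indicator P? = if does P? then 1 else 0

module _ {A : Set} where

  sum-map-+ : ∀ (f g : A → ℕ) xs →
    sum (map (λ x → f x + g x) xs) ≡ sum (map f xs) + sum (map g xs)
  sum-map-+ f g []       = refl
  sum-map-+ f g (x ∷ xs) = trans (cong (f x + g x +_) (sum-map-+ f g xs))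
                                 (interchange +-commutativeSemigroup (f x) (g x) _ _)

  sum-map-*ʳ : ∀ (f : A → ℕ) c xs → sum (map (λ x → f x * c) xs) ≡ sum (map f xs) * c
  sum-map-*ʳ f c []       = refl
  sum-map-*ʳ f c (x ∷ xs) = trans (cong (f x * c +_) (sum-map-*ʳ f c xs))
                                  (sym (*-distribʳ-+ c (f x) _))

  sum-map-zero : ∀ xs → sum (map (λ (_ : A) → 0) xs) ≡ 0
  sum-map-zero []       = refl
  sum-map-zero (_ ∷ xs) = sum-map-zero xs

  sum-map-mono-≤ : ∀ {f g : A → ℕ} → (∀ x → f x ≤ g x) → ∀ xs → sum (map f xs) ≤ sum (map g xs)
  sum-map-mono-≤ f≤g []       = z≤n
  sum-map-mono-≤ f≤g (x ∷ xs) = +-mono-≤ (f≤g x) (sum-map-mono-≤ f≤g xs)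

  length-concatMap-map : ∀ {B : A → Set} {C : Set} (g : ∀ x → B x → C) (f : ∀ x → List (B x)) xs →
    length (concatMap (λ x → map (g x) (f x)) xs) ≡ sum (map (λ x → length (f x)) xs)
  length-concatMap-map g f []       = refl
  length-concatMap-map g f (x ∷ xs) = begin
    length (map (g x) (f x) ++ concatMap (λ x → map (g x) (f x)) xs)
      ≡⟨ length-++ (map (g x) (f x)) ⟩
    length (map (g x) (f x)) + length (concatMap (λ x → map (g x) (f x)) xs)
      ≡⟨ cong₂ _+_ (length-map (g x) (f x)) (length-concatMap-map g f xs) ⟩
    length (f x) + sum (map (λ x → length (f x)) xs) ∎
    where open ≡-Reasoning

  count : ∀ {P : A → Set} → Decidable P → List A → ℕ
  count P? xs = sum (map (indicator ∘ P?) xs)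

  length-filter≡count : ∀ {P : A → Set} (P? : Decidable P) xs → length (filter P? xs) ≡ count P? xs
  length-filter≡count P? []       = refl
  length-filter≡count P? (x ∷ xs) with does (P? x)
  ... | true  = cong suc (length-filter≡count P? xs)
  ... | false = length-filter≡count P? xs

  count-++ : ∀ {P : A → Set} (P? : Decidable P) xs ys → count P? (xs ++ ys) ≡ count P? xs + count P? ys
  count-++ P? xs ys = trans (cong sum (map-++ (indicator ∘ P?) xs ys)) (sum-++ (map _ xs) _)

  injection-into-list⇒≤-length : ∀ {m} {xs : List A} (g : Fin m → A) → Injective _≡_ _≡_ g →
    (∀ a → g a ∈ xs) → m ≤ length xs
  injection-into-list⇒≤-length {xs = xs} g g-injective g∈xs = injective⇒≤ index-injective
    where
    index-injective : ∀ {a b} → index (g∈xs a) ≡ index (g∈xs b) → a ≡ b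
    index-injective {a} {b} eq = g-injective (begin
      g a                        ≡⟨ Any.lookup-index (g∈xs a) ⟩
      lookup xs (index (g∈xs a)) ≡⟨ cong (lookup xs) eq ⟩
      lookup xs (index (g∈xs b)) ≡⟨ Any.lookup-index (g∈xs b) ⟨
      g b                        ∎)
      where open ≡-Reasoning

sum-map-allFin-suc : ∀ {r} (f : Fin (suc r) → ℕ) →
  sum (map f (allFin (suc r))) ≡ f zero + sum (map (f ∘ suc) (allFin r))
sum-map-allFin-suc f =
  cong sum (trans (map-tabulate id f) (cong (f zero ∷_) (sym (map-tabulate id (f ∘ suc)))))

count-≟-allFin : ∀ {r} (q : Fin r) → count (q F.≟_) (allFin r) ≡ 1
count-≟-allFin {suc r} zero    =
  trans (sum-map-allFin-suc {r} (indicator ∘ (zero F.≟_))) (cong suc (sum-map-zero (allFin r)))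
count-≟-allFin {suc r} (suc q) =
  trans (sum-map-allFin-suc {r} (indicator ∘ (suc q F.≟_))) (count-≟-allFin q)

sum-count-≟ : ∀ {r} (qs : List (Fin r)) → sum (map (λ i → count (F._≟ i) qs) (allFin r)) ≡ length qs
sum-count-≟ {r} []       = sum-map-zero (allFin r)
sum-count-≟ {r} (q ∷ qs) = begin
  sum (map (λ i → indicator (q F.≟ i) + count (F._≟ i) qs) (allFin r))
    ≡⟨ sum-map-+ (indicator ∘ (q F.≟_)) (λ i → count (F._≟ i) qs) (allFin r) ⟩
  count (q F.≟_) (allFin r) + sum (map (λ i → count (F._≟ i) qs) (allFin r))
    ≡⟨ cong₂ _+_ (count-≟-allFin q) (sum-count-≟ qs) ⟩
  suc (length qs) ∎
  where open ≡-Reasoning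

odd-indicator : ∀ n → indicator (n % 2 ≟ 1) ≡ n % 2
odd-indicator 0             = refl
odd-indicator 1             = refl
odd-indicator (suc (suc n)) = odd-indicator n

round-up-to-even : ∀ n c → n ≤ c * 2 → n + n % 2 ≤ c * 2
round-up-to-even 0             c       n≤2c            = n≤2c
round-up-to-even 1             (suc c) _               = s≤s (s≤s z≤n)
round-up-to-even (suc (suc n)) (suc c) (s≤s (s≤s n≤2c)) = s≤s (s≤s (round-up-to-even n c n≤2c))

ceil4-≤ : ∀ k L → k ≤ L * 4 → ceil4 k ≤ L
ceil4-≤ k L k≤4L = ≤-pred (m<n*o⇒m/o<n (begin-strict
  k + 3     <⟨ +-monoʳ-< k ≤-refl ⟩
  k + 4     ≤⟨ +-monoˡ-≤ 4 k≤4L ⟩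
  L * 4 + 4 ≡⟨ +-comm (L * 4) 4 ⟩
  suc L * 4 ∎))
  where open ≤-Reasoning

≤-ceil4 : ∀ k L → L * 4 ≤ k + 3 → L ≤ ceil4 k
≤-ceil4 k L 4L≤k+3 = subst (_≤ ceil4 k) (m*n/n≡m L 4) (/-monoˡ-≤ 4 4L≤k+3)

module _ {G : Graph} where

  vertices : ∀ {u v k} → Walk G u v k → List (V G)
  vertices {u} stop       = u ∷ []
  vertices {u} (step _ w) = u ∷ vertices w

  OnWalk⇒∈vertices : ∀ {x u v k} {w : Walk G u v k} → OnWalk G x w → x ∈ vertices w
  OnWalk⇒∈vertices {w = stop}     here      = here refl
  OnWalk⇒∈vertices {w = step _ _} here      = here refl
  OnWalk⇒∈vertices                (there o) = there (OnWalk⇒∈vertices o)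

  walk-length≥1 : ∀ {u v k} → u ≢ v → Walk G u v k → 1 ≤ k
  walk-length≥1 u≢u stop       = contradiction refl u≢u
  walk-length≥1 _   (step _ _) = s≤s z≤n

  walk-length≥2 : ∀ {u v k} → u ≢ v → ¬ Adj G u v → Walk G u v k → 2 ≤ k
  walk-length≥2 u≢u _     stop              = contradiction refl u≢u
  walk-length≥2 _   u≁v   (step u~v stop)   = contradiction u~v u≁v
  walk-length≥2 _   _     (step _ (step _ _)) = s≤s (s≤s z≤n)

  trivialIsoPath : V G → IsoPath G
  trivialIsoPath u = isoPath u u 0 stop (λ _ → z≤n)

  edgeIsoPath : ∀ {u v} → Adj G u v → u ≢ v → IsoPath G
  edgeIsoPath {u} {v} u~v u≢v = isoPath u v 1 (step u~v stop) (walk-length≥1 u≢v)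

  twoStepIsoPath : ∀ {u w v} → Adj G u w → Adj G w v → u ≢ v → ¬ Adj G u v → IsoPath G
  twoStepIsoPath {u} {w} {v} u~w w~v u≢v u≁v =
    isoPath u v 2 (step u~w (step w~v stop)) (walk-length≥2 u≢v u≁v)

_∈²_ : ∀ {A : Set} → A → List (A × A) → Set
x ∈² uvs = Any (λ (u , v) → x ≡ u ⊎ x ≡ v) uvs

pairing : (N : ℕ) → List (Fin N × Fin N)
pairing 0             = []
pairing 1             = []
pairing (suc (suc N)) = (zero , suc zero) ∷ map (Product.map (2 F.↑ʳ_) (2 F.↑ʳ_)) (pairing N)

unpaired : (N : ℕ) → List (Fin N)
unpaired 0             = []
unpaired 1             = zero ∷ []
unpaired (suc (suc N)) = map (2 F.↑ʳ_) (unpaired N)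

length-unpaired : ∀ N → length (unpaired N) ≡ N % 2
length-unpaired 0             = refl
length-unpaired 1             = refl
length-unpaired (suc (suc N)) = trans (length-map (2 F.↑ʳ_) (unpaired N)) (length-unpaired N)

length-pairing : ∀ N → length (pairing N) * 2 + length (unpaired N) ≡ N
length-pairing 0             = refl
length-pairing 1             = refl
length-pairing (suc (suc N)) = cong (2 +_) (begin
  length (map _ (pairing N)) * 2 + length (map _ (unpaired N))
    ≡⟨ cong₂ (λ p u → p * 2 + u) (length-map _ (pairing N)) (length-map _ (unpaired N)) ⟩
  length (pairing N) * 2 + length (unpaired N)
    ≡⟨ length-pairing N ⟩
  N ∎)
  where open ≡-Reasoning

pairing-distinct : ∀ N → All (λ (a , b) → a ≢ b) (pairing N)
pairing-distinct 0             = []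
pairing-distinct 1             = []
pairing-distinct (suc (suc N)) =
  (λ ()) ∷ All.map⁺ (All.map (λ { a≢b refl → a≢b refl }) (pairing-distinct N))

unpaired-or-paired : ∀ N (a : Fin N) → a ∈ unpaired N ⊎ a ∈² pairing N
unpaired-or-paired (suc zero)    zero          = inj₁ (here refl)
unpaired-or-paired (suc (suc N)) zero          = inj₂ (here (inj₁ refl))
unpaired-or-paired (suc (suc N)) (suc zero)    = inj₂ (here (inj₂ refl))
unpaired-or-paired (suc (suc N)) (suc (suc a)) =
  Sum.map (∈-map⁺ (2 F.↑ʳ_)) (Any.there ∘ Any.map⁺ ∘ Any.map shift) (unpaired-or-paired N a)
  where
  shift : ∀ {(b , c) : Fin N × Fin N} → a ≡ b ⊎ a ≡ c → 2 F.↑ʳ a ≡ 2 F.↑ʳ b ⊎ 2 F.↑ʳ a ≡ 2 F.↑ʳ c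
  shift = Sum.map (cong (2 F.↑ʳ_)) (cong (2 F.↑ʳ_))

unpaired-AllPairs : ∀ N {R : Fin N → Fin N → Set} → AllPairs R (unpaired N)
unpaired-AllPairs 0             = []
unpaired-AllPairs 1             = [] ∷ []
unpaired-AllPairs (suc (suc N)) = AllPairs.map⁺ (unpaired-AllPairs N)

m*2+n<3*n⇒m<n : ∀ m n → m * 2 + n < 3 * n → m < n
m*2+n<3*n⇒m<n m n lt = *-cancelʳ-< 2 m n (+-cancelʳ-< n (m * 2) (n * 2) (subst (m * 2 + n <_) (3*n≡n*2+n n) lt))
  where
  3*n≡n*2+n : ∀ n → 3 * n ≡ n * 2 + n
  3*n≡n*2+n = solve-∀

module CompleteMultipartite (r : ℕ) (ns : Fin r → ℕ) where

  G : Graph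
  G = completeMultipartite r ns

  Vertex : Set
  Vertex = V G

  part : Vertex → Fin r
  part = proj₁

  -- Comparing the second components through toℕ avoids needing UIP for Fin r.
  ,-injectiveʳ : ∀ {i} {a b : Fin (ns i)} → (Vertex ∋ (i , a)) ≡ (i , b) → a ≡ b
  ,-injectiveʳ = toℕ-injective ∘ cong (toℕ ∘ proj₂)

  multiplicity : Fin r → List (Fin r) → ℕ
  multiplicity i = count (F._≟ i)

  partsOn : IsoPath G → List (Fin r)
  partsOn p = map part (vertices (walk p))

  partsOn-≤-take2 : ∀ p i → multiplicity i (partsOn p) ≤ multiplicity i (take 2 (partsOn p)) * 2
  partsOn-≤-take2 (isoPath _ _ _ stop _)          i = m≤m*n _ 2
  partsOn-≤-take2 (isoPath _ _ _ (step _ stop) _) i = m≤m*n _ 2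
  partsOn-≤-take2 (isoPath s t _ (step {w = m} s~m (step _ rest)) shortest) i
    with part s F.≟ part t
  ... | no s~t = contradiction (shortest (step s~t stop)) λ { (s≤s ()) }
  ... | yes s≈t with rest
  ...   | step _ _ = contradiction (shortest (step {w = m} s~m (step m~t stop))) λ { (s≤s (s≤s ())) }
    where
    m~t : ¬ part m ≡ part t
    m~t m≈t = s~m (trans s≈t (sym m≈t))
  ...   | stop rewrite sym s≈t = ≤-trans (m≤m+n _ b) (≤-reflexive (aba+b≡[a+b]*2 a b))
    where
    a = indicator (part s F.≟ i)
    b = indicator (part m F.≟ i)
    aba+b≡[a+b]*2 : ∀ a b → a + (b + (a + 0)) + b ≡ (a + (b + 0)) * 2
    aba+b≡[a+b]*2 = solve-∀

  charges : List (IsoPath G) → List (Fin r)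
  charges = concatMap (take 2 ∘ partsOn)

  length-charges : ∀ ps → length (charges ps) ≤ length ps * 2
  length-charges []       = z≤n
  length-charges (p ∷ ps) = begin
    length (take 2 (partsOn p) ++ charges ps)         ≡⟨ length-++ (take 2 (partsOn p)) ⟩
    length (take 2 (partsOn p)) + length (charges ps) ≤⟨ +-mono-≤ take2≤2 (length-charges ps) ⟩
    2 + length ps * 2                                 ∎
    where
    open ≤-Reasoning
    take2≤2 : length (take 2 (partsOn p)) ≤ 2
    take2≤2 = ≤-trans (≤-reflexive (length-take 2 (partsOn p))) (m⊓n≤m 2 _)

  partsOn-≤-charges : ∀ ps i →
    multiplicity i (concatMap partsOn ps) ≤ multiplicity i (charges ps) * 2
  partsOn-≤-charges []       i = z≤n
  partsOn-≤-charges (p ∷ ps) i = begin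
    multiplicity i (partsOn p ++ concatMap partsOn ps)
      ≡⟨ count-++ (F._≟ i) (partsOn p) _ ⟩
    multiplicity i (partsOn p) + multiplicity i (concatMap partsOn ps)
      ≤⟨ +-mono-≤ (partsOn-≤-take2 p i) (partsOn-≤-charges ps i) ⟩
    multiplicity i (take 2 (partsOn p)) * 2 + multiplicity i (charges ps) * 2
      ≡⟨ *-distribʳ-+ 2 (multiplicity i (take 2 (partsOn p))) _ ⟨
    (multiplicity i (take 2 (partsOn p)) + multiplicity i (charges ps)) * 2
      ≡⟨ cong (_* 2) (count-++ (F._≟ i) (take 2 (partsOn p)) _) ⟨
    multiplicity i (charges (p ∷ ps)) * 2 ∎
    where open ≤-Reasoning

  part-size≤multiplicity : ∀ i (xs : List Vertex) → (∀ a → (i , a) ∈ xs) →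
    ns i ≤ multiplicity i (map part xs)
  part-size≤multiplicity i xs part-i⊆xs = begin
    ns i                                    ≤⟨ injection-into-list⇒≤-length (i ,_) ,-injectiveʳ part-i⊆filter ⟩
    length (filter (λ v → part v F.≟ i) xs) ≡⟨ length-filter≡count (λ v → part v F.≟ i) xs ⟩
    count (λ v → part v F.≟ i) xs           ≡⟨ cong sum (map-∘ xs) ⟩
    multiplicity i (map part xs)            ∎
    where
    open ≤-Reasoning
    part-i⊆filter : ∀ a → (i , a) ∈ filter (λ v → part v F.≟ i) xs
    part-i⊆filter a = ∈-filter⁺ (λ v → part v F.≟ i) (part-i⊆xs a) refl

  numOdd≡sum-parities : numOdd r ns ≡ sum (map (λ i → ns i % 2) (allFin r))
  numOdd≡sum-parities = trans (length-filter≡count (λ i → ns i % 2 ≟ 1) (allFin r))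
                              (cong sum (map-cong (odd-indicator ∘ ns) (allFin r)))

  lowerBound : ∀ ps → Covers G ps → totalSize r ns + numOdd r ns ≤ length ps * 4
  lowerBound ps covers = begin
    totalSize r ns + numOdd r ns
      ≡⟨ cong (totalSize r ns +_) numOdd≡sum-parities ⟩
    sum (map ns (allFin r)) + sum (map (λ i → ns i % 2) (allFin r))
      ≡⟨ sum-map-+ ns (λ i → ns i % 2) (allFin r) ⟨
    sum (map (λ i → ns i + ns i % 2) (allFin r))
      ≤⟨ sum-map-mono-≤ (λ i → round-up-to-even (ns i) (multiplicity i (charges ps)) (part-size≤charges i)) (allFin r) ⟩
    sum (map (λ i → multiplicity i (charges ps) * 2) (allFin r))
      ≡⟨ sum-map-*ʳ (λ i → multiplicity i (charges ps)) 2 (allFin r) ⟩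
    sum (map (λ i → multiplicity i (charges ps)) (allFin r)) * 2
      ≡⟨ cong (_* 2) (sum-count-≟ (charges ps)) ⟩
    length (charges ps) * 2
      ≤⟨ *-monoˡ-≤ 2 (length-charges ps) ⟩
    length ps * 2 * 2
      ≡⟨ *-assoc (length ps) 2 2 ⟩
    length ps * 4 ∎
    where
    open ≤-Reasoning
    covered : ∀ x → x ∈ concatMap (vertices ∘ walk) ps
    covered x = Any.concatMap⁺ (vertices ∘ walk) (Any.map OnWalk⇒∈vertices (covers x))
    part-size≤charges : ∀ i → ns i ≤ multiplicity i (charges ps) * 2
    part-size≤charges i = begin
      ns i
        ≤⟨ part-size≤multiplicity i _ (λ a → covered (i , a)) ⟩
      multiplicity i (map part (concatMap (vertices ∘ walk) ps))
        ≡⟨ cong (multiplicity i) (map-concatMap part (vertices ∘ walk) ps) ⟩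
      multiplicity i (concatMap partsOn ps)
        ≤⟨ partsOn-≤-charges ps i ⟩
      multiplicity i (charges ps) * 2 ∎

  Covered : List (IsoPath G) → Vertex → Set
  Covered ps x = Any (λ p → OnWalk G x (walk p)) ps

  SamePart : Vertex × Vertex → Set
  SamePart (u , v) = part u ≡ part v × u ≢ v

  record PathCover (singles : List Vertex) (pairs : List (Vertex × Vertex)) : Set where
    field
      paths  : List (IsoPath G)
      covers : ∀ {x} → x ∈ singles ⊎ x ∈² pairs → Covered paths x
      size   : length paths * 2 ≤ length pairs + length singles + 1

  cover-clique : ∀ Sg → AllPairs (Adj G) Sg → PathCover Sg []
  cover-clique []       _ = record { paths = [] ; covers = λ { (inj₁ ()) ; (inj₂ ()) } ; size = z≤n }
  cover-clique (s ∷ []) _ = record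
    { paths  = trivialIsoPath s ∷ []
    ; covers = λ { (inj₁ (here refl)) → here here }
    ; size   = ≤-refl
    }
  cover-clique (s ∷ t ∷ Sg) ((s~t ∷ _) ∷ (_ ∷ clique)) = record
    { paths  = edgeIsoPath s~t (s~t ∘ cong part) ∷ paths
    ; covers = λ { (inj₁ (here refl))              → here here
                 ; (inj₁ (there (here refl)))      → here (there here)
                 ; (inj₁ (there (there x∈Sg)))     → there (covers (inj₁ x∈Sg))
                 }
    ; size   = s≤s (s≤s size)
    }
    where open PathCover (cover-clique Sg clique)

  prepend-twoStep : ∀ {u v m Sg Pr} → SamePart (u , v) → Adj G u m →
    PathCover Sg Pr → PathCover (m ∷ Sg) ((u , v) ∷ Pr)
  prepend-twoStep {Sg = Sg} {Pr} (u≈v , u≢v) u~m C = record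
    { paths  = twoStepIsoPath u~m m~v u≢v (λ u~v → u~v u≈v) ∷ paths
    ; covers = λ { (inj₁ (here refl))        → here (there here)
                 ; (inj₁ (there x∈Sg))       → there (covers (inj₁ x∈Sg))
                 ; (inj₂ (here (inj₁ refl))) → here here
                 ; (inj₂ (here (inj₂ refl))) → here (there (there here))
                 ; (inj₂ (there x∈Pr))       → there (covers (inj₂ x∈Pr))
                 }
    ; size   = s≤s (≤-trans (s≤s size) (≤-reflexive (cong (_+ 1) (sym (+-suc (length Pr) (length Sg))))))
    }
    where
    open PathCover C
    m~v = λ m≈v → u~m (trans u≈v (sym m≈v))

  swap-singles : ∀ {s₁ s₂ Sg Pr} → PathCover (s₂ ∷ s₁ ∷ Sg) Pr → PathCover (s₁ ∷ s₂ ∷ Sg) Pr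
  swap-singles C = record
    { paths  = paths
    ; covers = covers ∘ Sum.map₁ (Any-resp-↭ (↭-swap _ _ ↭-refl))
    ; size   = size
    }
    where open PathCover C

  cover-pairs-and-clique : ∀ Pr Sg → All SamePart Pr → AllPairs (Adj G) Sg →
    length Pr < length Sg → PathCover Sg Pr
  cover-pairs-and-clique []      Sg       _ clique _       = cover-clique Sg clique
  cover-pairs-and-clique (_ ∷ _) []       _ _      ()
  cover-pairs-and-clique (_ ∷ _) (_ ∷ []) _ _      (s≤s ())
  cover-pairs-and-clique ((u , v) ∷ Pr) (s₁ ∷ s₂ ∷ Sg) (uv ∷ same)
                         ((s₁~s₂ ∷ s₁~Sg) ∷ (s₂~Sg ∷ clique)) (s≤s Pr<Sg)
    with part u F.≟ part s₁
  -- s₁ and s₂ lie in different parts, so one of them is outside the part of u.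
  ... | no u~s₁  = prepend-twoStep uv u~s₁
                     (cover-pairs-and-clique Pr (s₂ ∷ Sg) same (s₂~Sg ∷ clique) Pr<Sg)
  ... | yes u≈s₁ = swap-singles (prepend-twoStep uv (λ u≈s₂ → s₁~s₂ (trans (sym u≈s₁) u≈s₂))
                     (cover-pairs-and-clique Pr (s₁ ∷ Sg) same (s₁~Sg ∷ clique) Pr<Sg))

  unpairedIn : Fin r → List Vertex
  unpairedIn i = map (i ,_) (unpaired (ns i))

  pairingIn : Fin r → List (Vertex × Vertex)
  pairingIn i = map (Product.map (i ,_) (i ,_)) (pairing (ns i))

  singles : List Vertex
  singles = concatMap unpairedIn (allFin r)

  pairs : List (Vertex × Vertex)
  pairs = concatMap pairingIn (allFin r)

  pairs-samePart : All SamePart pairs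
  pairs-samePart = All.concat⁺ (All.map⁺ (All.universal samePart (allFin r)))
    where
    samePart : ∀ i → All SamePart (pairingIn i)
    samePart i = All.map⁺ (All.map (λ a≢b → refl , a≢b ∘ ,-injectiveʳ) (pairing-distinct (ns i)))

  singles-clique : AllPairs (Adj G) singles
  singles-clique = AllPairs.concat⁺
    (All.map⁺ (All.universal (λ i → AllPairs.map⁺ (unpaired-AllPairs (ns i))) (allFin r)))
    (AllPairs.map⁺ (AllPairs.map across (allFin⁺ r)))
    where
    across : ∀ {i j} → i ≢ j → All (λ x → All (Adj G x) (unpairedIn j)) (unpairedIn i)
    across i≢j = All.map⁺ (All.universal (λ _ → All.map⁺ (All.universal (λ _ → i≢j) _)) _)

  singles-or-pairs : ∀ x → x ∈ singles ⊎ x ∈² pairs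
  singles-or-pairs (i , a) = Sum.map
    (Any.concatMap⁺ unpairedIn ∘ lose (∈-allFin i) ∘ ∈-map⁺ (i ,_))
    (Any.concatMap⁺ pairingIn ∘ lose (∈-allFin i) ∘ Any.map⁺ ∘ Any.map (Sum.map (cong (i ,_)) (cong (i ,_))))
    (unpaired-or-paired (ns i) a)

  numOdd≡length-singles : numOdd r ns ≡ length singles
  numOdd≡length-singles = begin
    numOdd r ns                                   ≡⟨ numOdd≡sum-parities ⟩
    sum (map (λ i → ns i % 2) (allFin r))         ≡⟨ cong sum (map-cong (length-unpaired ∘ ns) (allFin r)) ⟨
    sum (map (length ∘ unpaired ∘ ns) (allFin r)) ≡⟨ length-concatMap-map _,_ (unpaired ∘ ns) (allFin r) ⟨
    length singles                                ∎
    where open ≡-Reasoning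

  totalSize≡length-pairs*2+length-singles : totalSize r ns ≡ length pairs * 2 + length singles
  totalSize≡length-pairs*2+length-singles = begin
    sum (map ns (allFin r))
      ≡⟨ cong sum (map-cong (sym ∘ length-pairing ∘ ns) (allFin r)) ⟩
    sum (map (λ i → length (pairing (ns i)) * 2 + length (unpaired (ns i))) (allFin r))
      ≡⟨ sum-map-+ (λ i → length (pairing (ns i)) * 2) (length ∘ unpaired ∘ ns) (allFin r) ⟩
    sum (map (λ i → length (pairing (ns i)) * 2) (allFin r)) + sum (map (length ∘ unpaired ∘ ns) (allFin r))
      ≡⟨ cong (_+ sum (map (length ∘ unpaired ∘ ns) (allFin r))) (sum-map-*ʳ (length ∘ pairing ∘ ns) 2 (allFin r)) ⟩
    sum (map (length ∘ pairing ∘ ns) (allFin r)) * 2 + sum (map (length ∘ unpaired ∘ ns) (allFin r))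
      ≡⟨ cong₂ (λ p u → p * 2 + u) (length-concatMap-map (λ i → Product.map (i ,_) (i ,_)) (pairing ∘ ns) (allFin r))
                                    (length-concatMap-map _,_ (unpaired ∘ ns) (allFin r)) ⟨
    length pairs * 2 + length singles ∎
    where open ≡-Reasoning

  upperBound : totalSize r ns < 3 * numOdd r ns →
    Σ (List (IsoPath G)) λ ps → Covers G ps × length ps * 4 ≤ totalSize r ns + numOdd r ns + 3
  upperBound n<3α = paths , covers ∘ singles-or-pairs , (begin
    length paths * 4     ≡⟨ *-assoc (length paths) 2 2 ⟨
    length paths * 2 * 2 ≤⟨ *-monoˡ-≤ 2 size ⟩
    (P + S + 1) * 2      ≡⟨ double-bound P S ⟩
    (P * 2 + S) + S + 2  ≡⟨ cong₂ (λ n α → n + α + 2) n≡P*2+S α≡S ⟨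
    n + α + 2            ≤⟨ +-monoʳ-≤ (n + α) (n≤1+n 2) ⟩
    n + α + 3            ∎)
    where
    n = totalSize r ns
    α = numOdd r ns
    P = length pairs
    S = length singles
    n≡P*2+S = totalSize≡length-pairs*2+length-singles
    α≡S = numOdd≡length-singles
    open PathCover (cover-pairs-and-clique pairs singles pairs-samePart singles-clique
                      (m*2+n<3*n⇒m<n P S (subst₂ (λ n α → n < 3 * α) n≡P*2+S α≡S n<3α)))
    open ≤-Reasoning
    double-bound : ∀ p s → (p + s + 1) * 2 ≡ (p * 2 + s) + s + 2
    double-bound = solve-∀

lemma2 : (r : ℕ) → 2 ≤ r → (ns : Fin r → ℕ) →
    (∀ i j → i F.≤ j → ns j ≤ ns i) →
    (∀ i → 1 ≤ ns i) →
    totalSize r ns < 3 * numOdd r ns →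
    IsIsometricPathNumber (completeMultipartite r ns)
      (ceil4 (totalSize r ns + numOdd r ns))
lemma2 r _ ns _ _ n<3α with CompleteMultipartite.upperBound r ns n<3α
... | ps , covers , 4L≤n+α+3 =
  (ps , covers , ≤-antisym (≤-ceil4 _ _ 4L≤n+α+3) (atLeast ps covers)) , atLeast
  where
  atLeast : ∀ qs → Covers (completeMultipartite r ns) qs → ceil4 (totalSize r ns + numOdd r ns) ≤ length qs
  atLeast qs cover = ceil4-≤ _ _ (CompleteMultipartite.lowerBound r ns qs cover)
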